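{- Let $P$ be a finite poset with $n$ elements, let $G$ be its incomparability graph, and fix an arbitrary total order on the vertex set of $G$. Then the maps $\varphi_P:\mathcal{D}(P)\to\mathcal{AO}(G)$ and $\psi_P:\mathcal{AO}(G)\to\mathcal{D}(P)$ are bijections which are inverses of each other. Moreover, for every $\sigma\in\mathcal{D}(P)$, the left-to-right $P$-maxima of $\sigma$ are exactly the sinks of $\varphi_P(\sigma)$, and $\mathrm{inv}_G(\sigma)=\mathrm{asc}(\varphi_P(\sigma))$.
   Context: The incomparability graph $G$ of $P$ has vertex set $P$ and edges the pairs of distinct incomparable elements. A permutation of $P$ is a sequence $\sigma=(\sigma_1,\dots,\sigma_n)$ listing each element of $P$ exactly once. An index $i\in[n-1]$ is a $P$-descent of $\sigma$ if $\sigma_i>_P\sigma_{i+1}$; $\mathcal{D}(P)$ is the set of permutations of $P$ with no $P$-descent. $\sigma_j$ is a left-to-right $P$-maximum of $\sigma$ if $\sigma_i<_P\sigma_j$ for all $i<j$. $\mathrm{inv}_G(\sigma)$ is the number of pairs $i<j$ such that $\sigma_i$ is larger than $\sigma_j$ in the fixed total order and $\{\sigma_i,\sigma_j\}$ is an edge of $G$. An acyclic orientation of $G$ is a choice of direction for each edge such that the resulting directed graph has no directed cycle; $\mathcal{AO}(G)$ is the set of acyclic orientations. A sink is a vertex with no edge directed away from it. For an orientation $o$, $\mathrm{asc}(o)$ is the number of directed edges $b\to a$ such that $a$ is larger than $b$ in the fixed total order. $\varphi_P(\sigma)$ is the orientation of $G$ in which each edge $\{a,b\}$ is directed $b\to a$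 if $a$ precedes $b$ in $\sigma$. $\psi_P(o)$ is defined as follows: the sinks of $o$ are pairwise nonadjacent in $G$ and hence form a chain in $P$; let $\sigma_1$ be the $P$-smallest sink; then define $\sigma_2,\dots,\sigma_n$ by the same procedure applied to the poset obtained by deleting $\sigma_1$ from $P$ (with the restriction of $o$ to the induced subgraph on the remaining vertices), and set $\psi_P(o)=(\sigma_1,\dots,\sigma_n)$. -}

module Defs where

open import Level using (0ℓ)
open import Data.Nat using (ℕ; zero; suc)
open import Data.Bool using (Bool; true; false; T; not; _∧_; if_then_else_)
open import Data.Fin using (Fin; _<_) renaming (_<?_ to _<ᶠ?_)
open import Data.Fin.Properties using (_≟_)
open import Data.List using (List; []; _∷_; length; lookup; filter; filterᵇ; allFin; cartesianProduct)
open import Data.Bool.ListAction using (any; all)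
open import Data.List.Relation.Unary.Unique.Propositional using (Unique)
open import Data.List.Relation.Unary.Linked using (Linked)
open import Data.List.Membership.Propositional using (_∈_)
open import Data.Maybe using (Maybe; just; nothing)
open import Data.Product using (Σ; _×_; _,_)
open import Relation.Nullary using (¬_; ⌊_⌋; _×-dec_; ¬?)
open import Relation.Binary using (Rel; IsDecStrictPartialOrder; IsStrictTotalOrder)
open import Relation.Binary.PropositionalEquality using (_≡_; _≢_)
open import Relation.Binary.Construct.Closure.Transitive using (TransClosure)

module Setup {n : ℕ} {_<P_ : Rel (Fin n) 0ℓ} (isP : IsDecStrictPartialOrder _≡_ _<P_)
             {_≺_ : Rel (Fin n) 0ℓ} (isT : IsStrictTotalOrder _≡_ _≺_) where

  _<P?_ = IsDecStrictPartialOrder._<?_ isP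
  _≺?_ = IsStrictTotalOrder._<?_ isT

  Edge : Fin n → Fin n → Set
  Edge a b = a ≢ b × ¬ (a <P b) × ¬ (b <P a)

  edge? : (a b : Fin n) → _
  edge? a b = ¬? (a ≟ b) ×-dec ¬? (a <P? b) ×-dec ¬? (b <P? a)

  edgeᵇ : Fin n → Fin n → Bool
  edgeᵇ a b = ⌊ edge? a b ⌋

  -- an orientation: o a b ≡ true means the edge is directed a → b
  Orientation : Set
  Orientation = Fin n → Fin n → Bool

  IsOrientation : Orientation → Set
  IsOrientation o = ∀ a b → (T (o a b) → Edge a b)
                          × (Edge a b → T (o a b) × ¬ T (o b a) ⊎' ¬ T (o a b) × T (o b a))
    where
    open import Data.Sum using () renaming (_⊎_ to _⊎'_)

  Acyclic : Orientation → Set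
  Acyclic o = ∀ a → ¬ TransClosure (λ x y → T (o x y)) a a

  InAO : Orientation → Set
  InAO o = IsOrientation o × Acyclic o

  Sink : Orientation → Fin n → Set
  Sink o v = ∀ w → o v w ≡ false

  asc : Orientation → ℕ
  asc o = length (filter (λ p → T? (o (Data.Product.proj₁ p) (Data.Product.proj₂ p))
                                 ×-dec (Data.Product.proj₁ p ≺? Data.Product.proj₂ p))
                         (cartesianProduct (allFin n) (allFin n)))
    where open import Data.Bool.Properties using (T?)

  IsPerm : List (Fin n) → Set
  IsPerm σ = Unique σ × (∀ a → a ∈ σ)

  NoDescent : List (Fin n) → Set
  NoDescent σ = Linked (λ x y → ¬ (y <P x)) σ

  InD : List (Fin n) → Set
  InD σ = IsPerm σ × NoDescent σ

  precedesᵇ : Fin n → Fin n → List (Fin n) → Bool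
  precedesᵇ a b [] = false
  precedesᵇ a b (x ∷ xs) = if ⌊ x ≟ a ⌋ then any (λ y → ⌊ y ≟ b ⌋) xs else precedesᵇ a b xs

  φ : List (Fin n) → Orientation
  φ σ x y = edgeᵇ x y ∧ precedesᵇ y x σ

  LRMax : (σ : List (Fin n)) → Fin n → Set
  LRMax σ v = Σ (Fin (length σ)) λ j → lookup σ j ≡ v × (∀ i → i < j → lookup σ i <P lookup σ j)

  invG : List (Fin n) → ℕ
  invG σ = length (filter (λ p → (Data.Product.proj₁ p <ᶠ? Data.Product.proj₂ p)
                 ×-dec (lookup σ (Data.Product.proj₂ p) ≺? lookup σ (Data.Product.proj₁ p))
                 ×-dec edge? (lookup σ (Data.Product.proj₁ p)) (lookup σ (Data.Product.proj₂ p)))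
                 (cartesianProduct (allFin (length σ)) (allFin (length σ))))

  -- ψ_P: repeatedly remove the P-smallest sink of the restricted orientation
  module _ (o : Orientation) where
    sinkInᵇ : List (Fin n) → Fin n → Bool
    sinkInᵇ rem v = all (λ w → not (o v w)) rem

    pickMin : List (Fin n) → List (Fin n) → Maybe (Fin n)
    pickMin S [] = nothing
    pickMin S (s ∷ ss) = if all (λ t → ⌊ t ≟ s ⌋ Data.Bool.∨ ⌊ s <P? t ⌋) S
                           then just s else pickMin S ss

    go : ℕ → List (Fin n) → List (Fin n)
    go zero rem = []
    go (suc k) rem with pickMin (filterᵇ (sinkInᵇ rem) rem) (filterᵇ (sinkInᵇ rem) rem)
    ... | nothing = []
    ... | just s = s ∷ go k (filterᵇ (λ v → not ⌊ v ≟ s ⌋) rem)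

  ψ : Orientation → List (Fin n)
  ψ o = go o n (allFin n)

-- Call a list τ a realiser of an orientation o on a vertex list rem if it lists rem without
-- P-descents and o agrees with φ τ on rem. In a realiser every sink t of o is a left-to-right
-- P-maximum: an element u before t is not joined to t by an edge (it would be directed t → u),
-- so u and t are comparable, and the absence of descents forces u <P t. The head of a realiser
-- is a sink, so the heads of two realisers lie below each other and coincide: realisers are
-- unique. Every σ ∈ D(P) realises φ σ, and ψ o realises o when o is acyclic: the P-least sink s
-- goes first, and the next element h, a sink once s is removed, would be a sink below s if
-- h <P s. Everything else rests on "a precedes b in σ iff a has the smaller position": it makes
-- positions decrease along arcs of φ σ (acyclicity) and turns (i , j) ↦ (σ j , σ i) into a
-- bijection from the G-inversions of σ onto the ascents of φ σ.

module Submission where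

open import Defs
open import Level using (0ℓ)
open import Data.Nat using (ℕ; zero; suc; _≤_; s≤s⁻¹; z<s; s<s)
open import Data.Nat.Properties using (≤-trans; ≤-reflexive)
open import Data.Fin using (Fin; zero; suc; _<_)
open import Data.Fin.Properties using (_≟_; <-cmp; <-irrefl; <-trans)
open import Data.Bool using (Bool; true; false; T; not; _∧_; _∨_)
open import Data.Bool.Properties using (T?; T-≡; T-∧; T-∨; T-not-≡; ∧-identityʳ)
open import Data.Bool.ListAction using (any; all)
open import Data.Empty using (⊥-elim)
open import Data.Maybe using (just; nothing)
open import Data.Unit using (tt)
open import Data.Product using (∃-syntax; _×_; _,_; proj₁; proj₂)
open import Data.Sum using (_⊎_; inj₁; inj₂; [_,_]′) renaming (map to ⊎-map)
open import Data.List using (List; []; _∷_; length; lookup; map; filter; filterᵇ; allFin)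
open import Data.List.Properties using (filter-notAll; length-tabulate)
open import Data.List.Membership.Propositional using (_∈_; _∉_; find; lose)
open import Data.List.Membership.Propositional.Properties
  using (∈-map⁺; ∈-filter⁺; ∈-filter⁻; ∈-lookup; ∈-allFin; ∈-cartesianProduct⁺)
open import Data.List.Membership.Propositional.Properties.WithK using (unique∧set⇒bag)
open import Data.List.Relation.Binary.BagAndSetEquality using (∼bag⇒↭)
open import Data.List.Relation.Binary.Permutation.Propositional using (_↭_)
open import Data.List.Relation.Binary.Permutation.Propositional.Properties using (filter-↭; ↭-length)
open import Data.List.Relation.Binary.Subset.Propositional using (_⊆_)
open import Data.List.Relation.Unary.All as All using (All; []; _∷_)
open import Data.List.Relation.Unary.All.Properties using (all⁺; all⁻; ¬Any⇒All¬)
open import Data.List.Relation.Unary.Any as Any using (here; there; index; any?)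
open import Data.List.Relation.Unary.Any.Properties using (any⁺; any⁻; lookup-index)
open import Data.List.Relation.Unary.Linked as Linked using ([]; [-]; _∷_)
open import Data.List.Relation.Unary.AllPairs using ([]; _∷_)
open import Data.List.Relation.Unary.Unique.Propositional using (Unique)
open import Data.List.Relation.Unary.Unique.Propositional.Properties
  using (Unique[x∷xs]⇒x∉xs; map⁺; cartesianProduct⁺; allFin⁺)
open import Function using (_∘_; id)
open import Function.Bundles using (_⇔_; mk⇔; Equivalence)
open import Relation.Binary using (Rel; IsDecStrictPartialOrder; IsStrictTotalOrder; tri<; tri≈; tri>)
open import Relation.Binary.Construct.Closure.Transitive using (TransClosure; [_]; _∷_)
open import Relation.Binary.Construct.Closure.ReflexiveTransitive using (Star; ε; _◅_; _◅◅_)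
open import Relation.Binary.PropositionalEquality using (_≡_; _≢_; refl; sym; trans; cong; cong₂; subst; subst₂; module ≡-Reasoning)
open import Relation.Nullary using (¬_; Dec; yes; no; ⌊_⌋)
open import Relation.Nullary.Decidable using (toWitness; fromWitness; toWitnessFalse; fromWitnessFalse)
open import Relation.Unary using (Pred; Decidable)

open Equivalence using (to; from)

module _ {A B : Set} {P : Pred A 0ℓ} {Q : Pred B 0ℓ} (P? : Decidable P) (Q? : Decidable Q) where

  length-filter-map : (f : A → B) → (∀ {x} → P x ⇔ Q (f x)) → ∀ xs →
                      length (filter Q? (map f xs)) ≡ length (filter P? xs)
  length-filter-map f P⇔Q [] = refl
  length-filter-map f P⇔Q (x ∷ xs) with P? x | Q? (f x)
  ... | yes _  | yes _  = cong suc (length-filter-map f P⇔Q xs)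
  ... | no  _  | no  _  = length-filter-map f P⇔Q xs
  ... | yes px | no ¬qx = ⊥-elim (¬qx (to P⇔Q px))
  ... | no ¬px | yes qx = ⊥-elim (¬px (from P⇔Q qx))

  length-filter-bijection : (f : A → B) → (∀ {x y} → f x ≡ f y → x ≡ y) → (∀ y → ∃[ x ] f x ≡ y) →
                            (∀ {x} → P x ⇔ Q (f x)) → ∀ {xs ys} → Unique xs → Unique ys →
                            (∀ x → x ∈ xs) → (∀ y → y ∈ ys) →
                            length (filter P? xs) ≡ length (filter Q? ys)
  length-filter-bijection f f-injective f-surjective P⇔Q {xs} {ys} xs! ys! xs-complete ys-complete = begin
    length (filter P? xs)         ≡⟨ length-filter-map f P⇔Q xs ⟨
    length (filter Q? (map f xs)) ≡⟨ ↭-length (filter-↭ Q? map-f-xs↭ys) ⟩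
    length (filter Q? ys)         ∎
    where
    open ≡-Reasoning
    ∈-map-f-xs : ∀ {y} → y ∈ ys → y ∈ map f xs
    ∈-map-f-xs {y} _ with x , refl ← f-surjective y = ∈-map⁺ f (xs-complete x)
    map-f-xs↭ys : map f xs ↭ ys
    map-f-xs↭ys = ∼bag⇒↭ (unique∧set⇒bag (map⁺ f-injective xs!) ys! (mk⇔ (λ _ → ys-complete _) ∈-map-f-xs))

lookup-injective : ∀ {A : Set} {xs : List A} → Unique xs → ∀ {i j} → lookup xs i ≡ lookup xs j → i ≡ j
lookup-injective {xs = _ ∷ _}  _          {zero}  {zero}  _  = refl
lookup-injective {xs = _ ∷ _}  (x∉ ∷ _)   {zero}  {suc j} eq = ⊥-elim (All.lookup x∉ (∈-lookup j) eq)
lookup-injective {xs = _ ∷ _}  (x∉ ∷ _)   {suc i} {zero}  eq = ⊥-elim (All.lookup x∉ (∈-lookup i) (sym eq))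
lookup-injective {xs = _ ∷ _}  (_ ∷ xs!)  {suc i} {suc j} eq = cong suc (lookup-injective xs! eq)

module _ {A : Set} {R : Rel A 0ℓ} (R? : ∀ x y → Dec (R x y))
         (acyclic : ∀ a → ¬ TransClosure R a a) where

  ReachableSink : List A → A → Set
  ReachableSink xs v = ∃[ t ] t ∈ xs × All (λ w → ¬ R t w) xs × Star R v t

  private
    path-then-arc : ∀ {a b c} → Star R a b → R b c → TransClosure R a c
    path-then-arc ε            b→c = [ b→c ]
    path-then-arc (a→ ◅ path)  b→c = a→ ∷ path-then-arc path b→c

    head-reaches-sink : ∀ x xs → (∀ {v} → v ∈ xs → ReachableSink xs v) → ReachableSink (x ∷ xs) x
    head-reaches-sink x xs ih with any? (R? x) xs
    ... | no ¬out = x , here refl , (λ x→x → acyclic x [ x→x ]) ∷ ¬Any⇒All¬ xs ¬out , ε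
    ... | yes out with w , w∈xs , x→w ← find out with ih w∈xs
    ...   | t , t∈xs , t-sink , w⇝t with R? t x
    ...     | yes t→x = ⊥-elim (acyclic x (x→w ∷ path-then-arc w⇝t t→x))
    ...     | no ¬t→x = t , there t∈xs , ¬t→x ∷ t-sink , x→w ◅ w⇝t

  sink-reachable : ∀ xs {v} → v ∈ xs → ReachableSink xs v
  sink-reachable (x ∷ xs) (here refl) = head-reaches-sink x xs (sink-reachable xs)
  sink-reachable (x ∷ xs) (there v∈xs) with sink-reachable xs v∈xs
  ... | t , t∈xs , t-sink , v⇝t with R? t x
  ...   | no ¬t→x = t , there t∈xs , ¬t→x ∷ t-sink , v⇝t
  ...   | yes t→x with t′ , t′∈ , t′-sink , x⇝t′ ← head-reaches-sink x xs (sink-reachable xs)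
    = t′ , t′∈ , t′-sink , v⇝t ◅◅ (t→x ◅ x⇝t′)

¬T⇔≡false : ∀ {b} → (¬ T b) ⇔ b ≡ false
¬T⇔≡false {true}  = mk⇔ (λ ¬t → ⊥-elim (¬t _)) (λ ())
¬T⇔≡false {false} = mk⇔ (λ _ → refl) (λ _ ())

module Correspondence {n : ℕ} {_<P_ : Rel (Fin n) 0ℓ} (isP : IsDecStrictPartialOrder _≡_ _<P_)
                    {_≺_ : Rel (Fin n) 0ℓ} (isT : IsStrictTotalOrder _≡_ _≺_) where

  open Setup isP isT
  open IsDecStrictPartialOrder isP using (asym) renaming (trans to <P-trans)

  -- Positions in a list

  ∈⇔T-any : ∀ {b : Fin n} {xs} → b ∈ xs ⇔ T (any (λ y → ⌊ y ≟ b ⌋) xs)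
  ∈⇔T-any = mk⇔ (any⁺ _ ∘ Any.map (fromWitness ∘ sym)) (Any.map (sym ∘ toWitness) ∘ any⁻ _ _)

  precedes-here : ∀ {x b : Fin n} {xs} → precedesᵇ x b (x ∷ xs) ≡ any (λ y → ⌊ y ≟ b ⌋) xs
  precedes-here {x} with x ≟ x
  ... | yes _   = refl
  ... | no x≢x = ⊥-elim (x≢x refl)

  precedes-there : ∀ {a b x : Fin n} {xs} → x ≢ a → precedesᵇ a b (x ∷ xs) ≡ precedesᵇ a b xs
  precedes-there {a} {x = x} x≢a with x ≟ a
  ... | yes x≡a = ⊥-elim (x≢a x≡a)
  ... | no  _   = refl

  precedes⇒∈ : ∀ {a b : Fin n} xs → T (precedesᵇ a b xs) → b ∈ xs
  precedes⇒∈ {a} (x ∷ xs) p with x ≟ a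
  ... | yes _ = there (from ∈⇔T-any p)
  ... | no  _ = there (precedes⇒∈ xs p)

  precedes-head : ∀ {s y : Fin n} {τ} → s ∉ τ → ¬ T (precedesᵇ y s (s ∷ τ))
  precedes-head {s} {y} s∉τ p with s ≟ y
  ... | yes _ = s∉τ (from ∈⇔T-any p)
  ... | no  _ = s∉τ (precedes⇒∈ _ p)

  precedes-lookup⁺ : ∀ {σ} → Unique σ → ∀ {i j} → i < j → T (precedesᵇ (lookup σ i) (lookup σ j) σ)
  precedes-lookup⁺ {x ∷ xs} _ {zero} {suc j} _ rewrite precedes-here {x} {lookup xs j} {xs} =
    to ∈⇔T-any (∈-lookup {xs = xs} j)
  precedes-lookup⁺ {x ∷ xs} (x∉ ∷ xs!) {suc i} {suc j} (s<s i<j)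
    rewrite precedes-there {lookup xs i} {lookup xs j} {x} {xs} (All.lookup x∉ (∈-lookup i)) =
    precedes-lookup⁺ xs! i<j

  precedes-lookup⁻ : ∀ {σ} → Unique σ → ∀ {i j} → T (precedesᵇ (lookup σ i) (lookup σ j) σ) → i < j
  precedes-lookup⁻ {x ∷ xs} σ! {zero} {zero} p rewrite precedes-here {x} {x} {xs} =
    ⊥-elim (Unique[x∷xs]⇒x∉xs σ! (from ∈⇔T-any p))
  precedes-lookup⁻ {x ∷ xs} σ! {zero} {suc j} p = z<s
  precedes-lookup⁻ {x ∷ xs} σ!@(x∉ ∷ _) {suc i} {zero} p
    rewrite precedes-there {lookup xs i} {x} {x} {xs} (All.lookup x∉ (∈-lookup i)) =
    ⊥-elim (Unique[x∷xs]⇒x∉xs σ! (precedes⇒∈ xs p))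
  precedes-lookup⁻ {x ∷ xs} (x∉ ∷ xs!) {suc i} {suc j} p
    rewrite precedes-there {lookup xs i} {lookup xs j} {x} {xs} (All.lookup x∉ (∈-lookup i)) =
    s<s (precedes-lookup⁻ xs! p)

  precedes-index : ∀ {σ a b} → Unique σ → (a∈σ : a ∈ σ) (b∈σ : b ∈ σ) →
                   T (precedesᵇ a b σ) ⇔ index a∈σ < index b∈σ
  precedes-index {σ} σ! a∈σ b∈σ =
    subst₂ (λ a b → T (precedesᵇ a b σ) ⇔ index a∈σ < index b∈σ)
           (sym (lookup-index a∈σ)) (sym (lookup-index b∈σ))
           (mk⇔ (precedes-lookup⁻ σ!) (precedes-lookup⁺ σ!))

  -- The orientation φ σ

  Comparable : Fin n → Fin n → Set
  Comparable a b = a <P b ⊎ b <P a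

  Edge-sym : ∀ {a b} → Edge a b → Edge b a
  Edge-sym (a≢b , a≮b , b≮a) = a≢b ∘ sym , b≮a , a≮b

  ¬Edge⇒Comparable : ∀ {a b} → a ≢ b → ¬ Edge a b → Comparable a b
  ¬Edge⇒Comparable {a} {b} a≢b ¬edge with a <P? b | b <P? a
  ... | yes a<b | _       = inj₁ a<b
  ... | no  _   | yes b<a = inj₂ b<a
  ... | no  a≮b | no  b≮a = ⊥-elim (¬edge (a≢b , a≮b , b≮a))

  ≡⊎<-antisym : ∀ {a b} → a ≡ b ⊎ a <P b → b ≡ a ⊎ b <P a → a ≡ b
  ≡⊎<-antisym (inj₁ a≡b) _          = a≡b
  ≡⊎<-antisym (inj₂ _)   (inj₁ b≡a) = sym b≡a
  ≡⊎<-antisym (inj₂ a<b) (inj₂ b<a) = ⊥-elim (asym a<b b<a)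

  Comparable⇒¬Edge : ∀ {a b} → Comparable a b → ¬ Edge a b
  Comparable⇒¬Edge (inj₁ a<b) (_ , a≮b , _) = a≮b a<b
  Comparable⇒¬Edge (inj₂ b<a) (_ , _ , b≮a) = b≮a b<a

  T-φ : ∀ σ {a b} → T (φ σ a b) ⇔ (Edge a b × T (precedesᵇ b a σ))
  T-φ _ = mk⇔ (λ arc → let e , p = to T-∧ arc in toWitness e , p)
            (λ (e , p) → from T-∧ (fromWitness e , p))

  φ-there : ∀ {s x y : Fin n} {τ} → s ≢ y → φ (s ∷ τ) x y ≡ φ τ x y
  φ-there {x = x} {y} {τ} s≢y = cong (edgeᵇ x y ∧_) (precedes-there {y} {x} {xs = τ} s≢y)

  φ-head : ∀ {s y : Fin n} {τ} → s ∉ τ → φ (s ∷ τ) s y ≡ false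
  φ-head {τ = τ} s∉τ = to ¬T⇔≡false (precedes-head s∉τ ∘ proj₂ ∘ to (T-φ (_ ∷ τ)))

  φ-into-head : ∀ {s x : Fin n} {τ} → x ∈ τ → φ (s ∷ τ) x s ≡ edgeᵇ x s
  φ-into-head {s} {x} {τ} x∈τ = begin
    edgeᵇ x s ∧ precedesᵇ s x (s ∷ τ)           ≡⟨ cong (edgeᵇ x s ∧_) (precedes-here {s} {x} {τ}) ⟩
    edgeᵇ x s ∧ any (λ y → ⌊ y ≟ x ⌋) τ         ≡⟨ cong (edgeᵇ x s ∧_) (to T-≡ (to ∈⇔T-any x∈τ)) ⟩
    edgeᵇ x s ∧ true                            ≡⟨ ∧-identityʳ _ ⟩
    edgeᵇ x s                                   ∎
    where open ≡-Reasoning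

  φ-isOrientation : ∀ {σ} → IsPerm σ → IsOrientation (φ σ)
  φ-isOrientation {σ} (σ! , complete) a b = proj₁ ∘ to (T-φ σ) , orient
    where
    arc⇔ : ∀ {x y} → Edge x y → T (φ σ x y) ⇔ index (complete y) < index (complete x)
    arc⇔ {x} {y} e = mk⇔ (to (precedes-index σ! _ _) ∘ proj₂ ∘ to (T-φ σ))
                         (λ p → from (T-φ σ) (e , from (precedes-index σ! _ _) p))
    orient : Edge a b → T (φ σ a b) × ¬ T (φ σ b a) ⊎ ¬ T (φ σ a b) × T (φ σ b a)
    orient e with <-cmp (index (complete a)) (index (complete b))
    ... | tri< a<b _ b≮a = inj₂ (b≮a ∘ to (arc⇔ e) , from (arc⇔ (Edge-sym e)) a<b)
    ... | tri> a≮b _ b<a = inj₁ (from (arc⇔ e) b<a , a≮b ∘ to (arc⇔ (Edge-sym e)))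
    ... | tri≈ _ a≡b _   = ⊥-elim (proj₁ e (trans (lookup-index (complete a))
                                              (trans (cong (lookup σ) a≡b) (sym (lookup-index (complete b))))))

  φ-acyclic : ∀ {σ} → IsPerm σ → Acyclic (φ σ)
  φ-acyclic {σ} (σ! , complete) a cycle = <-irrefl refl (descends cycle)
    where
    rank : Fin n → Fin (length σ)
    rank x = index (complete x)
    descends : ∀ {x y} → TransClosure (λ x y → T (φ σ x y)) x y → rank y < rank x
    descends [ arc ]      = to (precedes-index σ! _ _) (proj₂ (to (T-φ σ) arc))
    descends (arc ∷ path) = <-trans (descends path) (descends [ arc ])

  φ-InAO : ∀ {σ} → InD σ → InAO (φ σ)
  φ-InAO (σ-perm , _) = φ-isOrientation σ-perm , φ-acyclic σ-perm

  -- Realisers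

  ascending-before : ∀ {xs} → NoDescent xs → ∀ {j} →
                     (∀ {i} → i < j → Comparable (lookup xs i) (lookup xs j)) →
                     ∀ {i} → i < j → lookup xs i <P lookup xs j
  ascending-before {_ ∷ _ ∷ _} (_ ∷ nd)  {suc j} cmp {suc i} (s<s i<j) =
    ascending-before nd (cmp ∘ s<s) i<j
  ascending-before {_ ∷ _ ∷ _} (y≮x ∷ _) {suc zero} cmp {zero} _ = [ id , ⊥-elim ∘ y≮x ]′ (cmp z<s)
  -- lookup xs j <P x is impossible: the successor y of x lies below lookup xs j, so y <P x would be a descent.
  ascending-before {_ ∷ _ ∷ _} (y≮x ∷ nd) {suc (suc j)} cmp {zero} _ =
    [ id , (λ v<x → ⊥-elim (y≮x (<P-trans (ascending-before nd (cmp ∘ s<s) z<s) v<x))) ]′ (cmp z<s)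

  SinkIn : Orientation → List (Fin n) → Fin n → Set
  SinkIn o rem t = All (λ w → ¬ T (o t w)) rem

  remove : Fin n → List (Fin n) → List (Fin n)
  remove s = filterᵇ (λ v → not ⌊ v ≟ s ⌋)

  ∈-remove⁺ : ∀ {s v xs} → v ∈ xs → v ≢ s → v ∈ remove s xs
  ∈-remove⁺ {s} v∈xs v≢s = ∈-filter⁺ (T? ∘ λ v → not ⌊ v ≟ s ⌋) v∈xs (fromWitnessFalse v≢s)

  ∈-remove⁻ : ∀ {s v} xs → v ∈ remove s xs → v ∈ xs × v ≢ s
  ∈-remove⁻ {s} xs v∈ with v∈xs , v≢s ← ∈-filter⁻ (T? ∘ λ v → not ⌊ v ≟ s ⌋) {xs = xs} v∈ =
    v∈xs , toWitnessFalse v≢s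

  ∈-remove-or : ∀ {s v xs} → v ∈ xs → v ≡ s ⊎ v ∈ remove s xs
  ∈-remove-or {s} {v} v∈xs with v ≟ s
  ... | yes v≡s = inj₁ v≡s
  ... | no  v≢s = inj₂ (∈-remove⁺ v∈xs v≢s)

  record Realises (o : Orientation) (rem τ : List (Fin n)) : Set where
    field
      sound     : τ ⊆ rem
      complete  : rem ⊆ τ
      unique    : Unique τ
      noDescent : NoDescent τ
      agrees    : ∀ {x y} → x ∈ rem → y ∈ rem → o x y ≡ φ τ x y

  module _ {o : Orientation} where

    head-sink : ∀ {rem h τ} → Realises o rem (h ∷ τ) → SinkIn o rem h
    head-sink r = All.tabulate λ w∈rem →
      from ¬T⇔≡false (trans (agrees (sound (here refl)) w∈rem) (φ-head (Unique[x∷xs]⇒x∉xs unique)))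
      where open Realises r

    sink⇒LRMax : ∀ {rem τ t} → Realises o rem τ → t ∈ τ → SinkIn o rem t → LRMax τ t
    sink⇒LRMax {rem} {τ} r t∈τ t-sink =
      j , sym (lookup-index t∈τ) , λ _ i<j → ascending-before noDescent comparable i<j
      where
      open Realises r
      j : Fin (length τ)
      j = index t∈τ
      earlier-no-arc : ∀ {i} → i < j → ¬ T (o (lookup τ j) (lookup τ i))
      earlier-no-arc {i} _ = All.lookup (subst (SinkIn o rem) (lookup-index t∈τ) t-sink) (sound (∈-lookup i))
      comparable : ∀ {i} → i < j → Comparable (lookup τ i) (lookup τ j)
      comparable {i} i<j = ¬Edge⇒Comparable (λ eq → <-irrefl (lookup-injective unique eq) i<j) λ e →
        earlier-no-arc i<j (subst T (sym (agrees (sound (∈-lookup j)) (sound (∈-lookup i))))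
                                    (from (T-φ τ) (Edge-sym e , precedes-lookup⁺ unique i<j)))

    head-below-sink : ∀ {rem h τ t} → Realises o rem (h ∷ τ) → t ∈ h ∷ τ → SinkIn o rem t → h ≡ t ⊎ h <P t
    head-below-sink r t∈ t-sink with sink⇒LRMax r t∈ t-sink
    ... | zero  , h≡t , _     = inj₁ h≡t
    ... | suc _ , j≡t , below = inj₂ (subst (_ <P_) j≡t (below zero z<s))

    Realises-tail : ∀ {rem h τ} → Realises o rem (h ∷ τ) → Realises o (remove h rem) τ
    Realises-tail {rem} {h} {τ} r = record
      { sound     = λ v∈τ → ∈-remove⁺ (sound (there v∈τ)) (λ { refl → h∉τ v∈τ })
      ; complete  = λ v∈rem′ → let v∈rem , v≢h = ∈-remove⁻ rem v∈rem′ in drop-head v≢h (complete v∈rem)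
      ; unique    = τ!
      ; noDescent = Linked.tail noDescent
      ; agrees    = λ x∈rem′ y∈rem′ → let y∈rem , y≢h = ∈-remove⁻ rem y∈rem′ in
                      trans (agrees (proj₁ (∈-remove⁻ rem x∈rem′)) y∈rem) (φ-there {τ = τ} (y≢h ∘ sym))
      }
      where
      open Realises r
      h∉τ : h ∉ τ
      h∉τ = Unique[x∷xs]⇒x∉xs unique
      τ! : Unique τ
      τ! with _ ∷ τ! ← unique = τ!
      drop-head : ∀ {v} → v ≢ h → v ∈ h ∷ τ → v ∈ τ
      drop-head v≢h (here v≡h)  = ⊥-elim (v≢h v≡h)
      drop-head _   (there v∈τ) = v∈τ

    realiser-⊆ : ∀ {rem σ τ} → Realises o rem σ → Realises o rem τ → σ ⊆ τ
    realiser-⊆ rσ rτ = Realises.complete rτ ∘ Realises.sound rσ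

    realisers-unique : ∀ {rem σ τ} → Realises o rem σ → Realises o rem τ → σ ≡ τ
    realisers-unique {σ = []}    {[]}    _  _  = refl
    realisers-unique {σ = []}    {_ ∷ _} rσ rτ with () ← realiser-⊆ rτ rσ (here refl)
    realisers-unique {σ = _ ∷ _} {[]}    rσ rτ with () ← realiser-⊆ rσ rτ (here refl)
    realisers-unique {σ = s ∷ _} {t ∷ _} rσ rτ
      with refl ← ≡⊎<-antisym (head-below-sink rσ (realiser-⊆ rτ rσ (here refl)) (head-sink rτ))
                              (head-below-sink rτ (realiser-⊆ rσ rτ (here refl)) (head-sink rσ))
      = cong (s ∷_) (realisers-unique (Realises-tail rσ) (Realises-tail rτ))

  -- The construction ψ

  IsMin : List (Fin n) → Fin n → Set
  IsMin S s = All (λ t → t ≡ s ⊎ s <P t) S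

  Chain : List (Fin n) → Set
  Chain S = ∀ {s t} → s ∈ S → t ∈ S → s ≡ t ⊎ Comparable s t

  chain-minimum : ∀ {S x} → Chain S → x ∈ S → ∃[ m ] m ∈ S × IsMin S m
  chain-minimum {y ∷ []} _ _ = y , here refl , inj₁ refl ∷ []
  chain-minimum {y ∷ z ∷ zs} chain _
    with m , m∈ , m-min ← chain-minimum {z ∷ zs} (λ s∈ t∈ → chain (there s∈) (there t∈)) (here refl)
    with chain (here refl) (there m∈)
  ... | inj₁ y≡m        = m , there m∈ , inj₁ y≡m ∷ m-min
  ... | inj₂ (inj₂ m<y) = m , there m∈ , inj₂ m<y ∷ m-min
  ... | inj₂ (inj₁ y<m) = y , here refl , inj₁ refl ∷ All.map below-y m-min
    where
    below-y : ∀ {t} → t ≡ m ⊎ m <P t → t ≡ y ⊎ y <P t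
    below-y (inj₁ refl) = inj₂ y<m
    below-y (inj₂ m<t)  = inj₂ (<P-trans y<m m<t)

  T-isMinᵇ : ∀ {S s} → T (all (λ t → ⌊ t ≟ s ⌋ ∨ ⌊ s <P? t ⌋) S) ⇔ IsMin S s
  T-isMinᵇ {S} {s} = mk⇔ (All.map (to T-below) ∘ all⁺ isMinᵇ S) (all⁻ isMinᵇ ∘ All.map (from T-below))
    where
    isMinᵇ : Fin n → Bool
    isMinᵇ t = ⌊ t ≟ s ⌋ ∨ ⌊ s <P? t ⌋
    T-below : ∀ {t} → T (isMinᵇ t) ⇔ (t ≡ s ⊎ s <P t)
    T-below {t} = mk⇔ (⊎-map toWitness toWitness ∘ to (T-∨ {⌊ t ≟ s ⌋}))
                      (from (T-∨ {⌊ t ≟ s ⌋}) ∘ ⊎-map (fromWitness {a? = t ≟ s}) (fromWitness {a? = s <P? t}))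

  module _ {o : Orientation} where

    pickMin-just : ∀ S L {s} → pickMin o S L ≡ just s → s ∈ L × IsMin S s
    pickMin-just S (x ∷ L) eq with all (λ t → ⌊ t ≟ x ⌋ ∨ ⌊ x <P? t ⌋) S in isMin
    ... | true with refl ← eq = here refl , to T-isMinᵇ (subst T (sym isMin) tt)
    ... | false with s∈L , s-min ← pickMin-just S L eq = there s∈L , s-min

    pickMin-nothing : ∀ S L {m} → pickMin o S L ≡ nothing → m ∈ L → ¬ IsMin S m
    pickMin-nothing S (x ∷ L) eq m∈ m-min with all (λ t → ⌊ t ≟ x ⌋ ∨ ⌊ x <P? t ⌋) S in isMin | m∈
    ... | true  | _          with () ← eq
    ... | false | here refl  = subst T isMin (from T-isMinᵇ m-min)
    ... | false | there m∈L  = pickMin-nothing S L eq m∈L m-min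

    sinks : List (Fin n) → List (Fin n)
    sinks rem = filterᵇ (sinkInᵇ o rem) rem

    T-sinkInᵇ : ∀ {rem t} → T (sinkInᵇ o rem t) ⇔ SinkIn o rem t
    T-sinkInᵇ {rem} {t} = mk⇔ (All.map (from ¬T⇔≡false ∘ to T-not-≡) ∘ all⁺ (not ∘ o t) rem)
                              (all⁻ (not ∘ o t) ∘ All.map (from T-not-≡ ∘ to ¬T⇔≡false))

    ∈-sinks⁺ : ∀ {rem t} → t ∈ rem → SinkIn o rem t → t ∈ sinks rem
    ∈-sinks⁺ {rem} t∈rem t-sink = ∈-filter⁺ (T? ∘ sinkInᵇ o rem) t∈rem (from T-sinkInᵇ t-sink)

    ∈-sinks⁻ : ∀ {rem t} → t ∈ sinks rem → t ∈ rem × SinkIn o rem t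
    ∈-sinks⁻ {rem} t∈ with t∈rem , t-sink ← ∈-filter⁻ (T? ∘ sinkInᵇ o rem) {xs = rem} t∈ =
      t∈rem , to T-sinkInᵇ t-sink

    sinks-chain : IsOrientation o → ∀ {rem} → Chain (sinks rem)
    sinks-chain isO {rem} {s} {t} s∈ t∈ with s ≟ t | ∈-sinks⁻ {rem} s∈ | ∈-sinks⁻ {rem} t∈
    ... | yes s≡t | _ | _ = inj₁ s≡t
    ... | no  s≢t | s∈rem , s-sink | t∈rem , t-sink = inj₂ (¬Edge⇒Comparable s≢t λ e →
          [ (λ (s→t , _) → All.lookup s-sink t∈rem s→t) , (λ (_ , t→s) → All.lookup t-sink s∈rem t→s) ]′
          (proj₂ (isO s t) e))

    sink-incoming : IsOrientation o → ∀ {s x} → ¬ T (o s x) → o x s ≡ edgeᵇ x s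
    sink-incoming isO {s} {x} ¬s→x with edge? x s
    ... | yes e = [ to T-≡ ∘ proj₁ , ⊥-elim ∘ ¬s→x ∘ proj₂ ]′ (proj₂ (isO x s) e)
    ... | no ¬e = to ¬T⇔≡false (¬e ∘ proj₁ (isO x s))

    realises-[] : Realises o [] []
    realises-[] = record { sound = λ () ; complete = λ () ; unique = [] ; noDescent = [] ; agrees = λ () }

    SinkIn-remove : ∀ {rem s h} → SinkIn o (remove s rem) h → ¬ T (o h s) → SinkIn o rem h
    SinkIn-remove h-sink ¬h→s =
      All.tabulate λ w∈rem → [ (λ { refl → ¬h→s }) , All.lookup h-sink ]′ (∈-remove-or w∈rem)

    Realises-cons : IsOrientation o → ∀ {rem s τ} → s ∈ rem → SinkIn o rem s → IsMin (sinks rem) s →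
                    Realises o (remove s rem) τ → Realises o rem (s ∷ τ)
    Realises-cons isO {rem} {s} {τ} s∈rem s-sink s-min r = record
      { sound     = λ { (here refl) → s∈rem ; (there v∈τ) → proj₁ (∈-remove⁻ rem (sound v∈τ)) }
      ; complete  = [ (λ { refl → here refl }) , there ∘ complete ]′ ∘ ∈-remove-or
      ; unique    = All.tabulate (λ v∈τ s≡v → proj₂ (∈-remove⁻ rem (sound v∈τ)) (sym s≡v)) ∷ unique
      ; noDescent = noDescent-after-s r
      ; agrees    = agrees-with-s
      }
      where
      open Realises r
      noDescent-after-s : ∀ {τ} → Realises o (remove s rem) τ → NoDescent (s ∷ τ)
      noDescent-after-s {[]}    _  = [-]
      noDescent-after-s {h ∷ _} rh with h∈rem , h≢s ← ∈-remove⁻ rem (Realises.sound rh (here refl)) =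
        h≮s ∷ Realises.noDescent rh
        where
        -- h heads a realiser of rem minus s; if h <P s, there is no arc h → s, so h is a sink of rem below s
        h≮s : ¬ h <P s
        h≮s h<s = [ h≢s , asym h<s ]′ (All.lookup s-min (∈-sinks⁺ h∈rem h-sink))
          where
          h-sink : SinkIn o rem h
          h-sink = SinkIn-remove (head-sink rh) (Comparable⇒¬Edge (inj₁ h<s) ∘ proj₁ (isO h s))
      agrees-with-s : ∀ {x y} → x ∈ rem → y ∈ rem → o x y ≡ φ (s ∷ τ) x y
      agrees-with-s {x} {y} x∈rem y∈rem with x ≟ s | y ≟ s
      ... | yes refl | _ =
        trans (to ¬T⇔≡false (All.lookup s-sink y∈rem))
              (sym (φ-head (λ s∈τ → proj₂ (∈-remove⁻ rem (sound s∈τ)) refl)))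
      ... | no x≢s | yes refl =
        trans (sink-incoming isO (All.lookup s-sink x∈rem)) (sym (φ-into-head (complete (∈-remove⁺ x∈rem x≢s))))
      ... | no x≢s | no y≢s =
        trans (agrees (∈-remove⁺ x∈rem x≢s) (∈-remove⁺ y∈rem y≢s)) (sym (φ-there {τ = τ} (y≢s ∘ sym)))

    least-sink : InAO o → ∀ {rem r} → r ∈ rem → ∃[ m ] m ∈ sinks rem × IsMin (sinks rem) m
    least-sink (isO , acyclic) {rem} r∈rem
      with t , t∈rem , t-sink , _ ← sink-reachable (λ x y → T? (o x y)) acyclic rem r∈rem
      = chain-minimum (sinks-chain isO {rem}) (∈-sinks⁺ t∈rem t-sink)

    go-realises : InAO o → ∀ k rem → length rem ≤ k → Realises o rem (go o k rem)
    go-realises _ zero    []      _ = realises-[]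
    go-realises _ (suc k) []      _ = realises-[]
    go-realises o∈AO@(isO , _) (suc k) rem@(_ ∷ _) len with pickMin o (sinks rem) (sinks rem) in eq
    ... | nothing with m , m∈ , m-min ← least-sink o∈AO {rem} (here refl) =
      ⊥-elim (pickMin-nothing (sinks rem) (sinks rem) eq m∈ m-min)
    ... | just s with s∈ , s-min ← pickMin-just (sinks rem) (sinks rem) eq =
      Realises-cons isO s∈rem (proj₂ (∈-sinks⁻ s∈)) s-min (go-realises o∈AO k (remove s rem) shorter)
      where
      s∈rem : s ∈ rem
      s∈rem = proj₁ (∈-sinks⁻ s∈)
      shorter : length (remove s rem) ≤ k
      shorter = s≤s⁻¹ (≤-trans (filter-notAll (T? ∘ λ v → not ⌊ v ≟ s ⌋) rem
                                              (lose s∈rem (λ s≢s → toWitnessFalse s≢s refl))) len)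

    ψ-realises : InAO o → Realises o (allFin n) (ψ o)
    ψ-realises o∈AO = go-realises o∈AO n (allFin n) (≤-reflexive (length-tabulate id))

  -- The correspondence and its statistics

  self-realises : ∀ {σ} → InD σ → Realises (φ σ) (allFin n) σ
  self-realises ((σ! , complete) , σ-noDescent) = record
    { sound = λ {a} _ → ∈-allFin a ; complete = λ {a} _ → complete a
    ; unique = σ! ; noDescent = σ-noDescent ; agrees = λ _ _ → refl }

  ψ-φ : ∀ {σ} → InD σ → ψ (φ σ) ≡ σ
  ψ-φ σ∈D = realisers-unique (ψ-realises (φ-InAO σ∈D)) (self-realises σ∈D)

  ψ-InD : ∀ {o} → InAO o → InD (ψ o)
  ψ-InD o∈AO = (unique , λ a → complete (∈-allFin a)) , noDescent
    where open Realises (ψ-realises o∈AO)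

  φ-ψ : ∀ {o} → InAO o → ∀ a b → φ (ψ o) a b ≡ o a b
  φ-ψ o∈AO a b = sym (Realises.agrees (ψ-realises o∈AO) (∈-allFin a) (∈-allFin b))

  LRMax⇒Sink : ∀ {σ v} → IsPerm σ → LRMax σ v → Sink (φ σ) v
  LRMax⇒Sink {σ} (σ! , complete) (j , refl , below) w = to ¬T⇔≡false λ arc →
    let (_ , _ , w≮v) , w-before = to (T-φ σ) arc in w≮v (earlier-below (complete w) w-before)
    where
    earlier-below : ∀ {u} → u ∈ σ → T (precedesᵇ u (lookup σ j) σ) → u <P lookup σ j
    earlier-below u∈σ p = subst (_<P lookup σ j) (sym (lookup-index u∈σ))
      (below _ (precedes-lookup⁻ σ! (subst (λ u → T (precedesᵇ u (lookup σ j) σ)) (lookup-index u∈σ) p)))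

  LRMax⇔Sink : ∀ {σ v} → InD σ → LRMax σ v ⇔ Sink (φ σ) v
  LRMax⇔Sink {v = v} σ∈D@((_ , complete) , _) = mk⇔ (LRMax⇒Sink (proj₁ σ∈D)) λ sink →
    sink⇒LRMax (self-realises σ∈D) (complete v) (All.tabulate λ {w} _ → from ¬T⇔≡false (sink w))

  invG≡asc : ∀ {σ} → IsPerm σ → invG σ ≡ asc (φ σ)
  invG≡asc {σ} (σ! , complete) =
    length-filter-bijection _ _ swap-lookup swap-lookup-injective swap-lookup-surjective
      (λ {ij} → inversion⇔ascent {proj₁ ij} {proj₂ ij})
      (cartesianProduct⁺ (allFin⁺ _) (allFin⁺ _)) (cartesianProduct⁺ (allFin⁺ _) (allFin⁺ _))
      (λ (i , j) → ∈-cartesianProduct⁺ (∈-allFin i) (∈-allFin j))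
      (λ (a , b) → ∈-cartesianProduct⁺ (∈-allFin a) (∈-allFin b))
    where
    swap-lookup : Fin (length σ) × Fin (length σ) → Fin n × Fin n
    swap-lookup (i , j) = lookup σ j , lookup σ i
    swap-lookup-injective : ∀ {ij kl} → swap-lookup ij ≡ swap-lookup kl → ij ≡ kl
    swap-lookup-injective eq =
      cong₂ _,_ (lookup-injective σ! (cong proj₂ eq)) (lookup-injective σ! (cong proj₁ eq))
    swap-lookup-surjective : ∀ ab → ∃[ ij ] swap-lookup ij ≡ ab
    swap-lookup-surjective (a , b) = (index (complete b) , index (complete a)) ,
      cong₂ _,_ (sym (lookup-index (complete a))) (sym (lookup-index (complete b)))
    inversion⇔ascent : ∀ {i j} →
      (i < j × lookup σ j ≺ lookup σ i × Edge (lookup σ i) (lookup σ j))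
      ⇔ (T (φ σ (lookup σ j) (lookup σ i)) × lookup σ j ≺ lookup σ i)
    inversion⇔ascent = mk⇔
      (λ (i<j , j≺i , e) → from (T-φ σ) (Edge-sym e , precedes-lookup⁺ σ! i<j) , j≺i)
      (λ (arc , j≺i) → let e , p = to (T-φ σ) arc in precedes-lookup⁻ σ! p , j≺i , Edge-sym e)

lemma4p1 : (n : ℕ) (_<P_ : Rel (Fin n) 0ℓ) (isP : IsDecStrictPartialOrder _≡_ _<P_)
           (_≺_ : Rel (Fin n) 0ℓ) (isT : IsStrictTotalOrder _≡_ _≺_) →
           let open Setup isP isT in
           (∀ σ → InD σ → InAO (φ σ) × ψ (φ σ) ≡ σ
                  × (∀ v → LRMax σ v ⇔ Sink (φ σ) v) × invG σ ≡ asc (φ σ))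
           × (∀ o → InAO o → InD (ψ o) × (∀ a b → φ (ψ o) a b ≡ o a b))
lemma4p1 n _<P_ isP _≺_ isT =
  (λ σ σ∈D → φ-InAO σ∈D , ψ-φ σ∈D , (λ v → LRMax⇔Sink σ∈D) , invG≡asc (proj₁ σ∈D)) ,
  (λ o o∈AO → ψ-InD o∈AO , φ-ψ o∈AO)
  where open Correspondence isP isT
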